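{- Let $\mathcal{A}$ be a safety one-way alternating automaton with $1$ register (safety 1ARA$_1$) over a finite alphabet $\Sigma$. Then its language $\mathrm{L}(\mathcal{A})$ is a safety set of data $\omega$-words: for every data $\omega$-word $\sigma$ over $\Sigma$, if for every $i > 0$ there exists $\sigma'_i \in \mathrm{L}(\mathcal{A})$ whose $i$-prefix equals the $i$-prefix of $\sigma$, then $\sigma \in \mathrm{L}(\mathcal{A})$.
   Context: A data $\omega$-word $\sigma$ over a finite alphabet $\Sigma$ consists of an $\omega$-word $\mathrm{str}(\sigma)=\sigma(0)\sigma(1)\cdots$ over $\Sigma$ together with an equivalence relation $\sim$ on $\mathbb{N}$; $[i]_\sim$ denotes the class of $i$. For $i>0$, the $i$-prefix of $\sigma$ is the finite data word with letters $\sigma(0)\cdots\sigma(i-1)$ and equivalence relation $\sim$ restricted to $\{0,\dots,i-1\}$. For a finite set $Q$, let $\downarrow Q=\{\downarrow q : q\in Q\}$ (disjoint from $Q$) and let $\mathcal{B}^+_\downarrow(Q)$ be the set of positive Boolean formulae built from atoms $q$, $\downarrow q$ ($q\in Q$), $\top$, $\bot$ with $\wedge,\vee$. A pair $Q',Q'_\downarrow\subseteq Q$ satisfies $q$ iff $q\in Q'$, satisfies $\downarrow q$ iff $q\in Q'_\downarrow$, always satisfies $\top$, never $\bot$, and $\wedge,\vee$ are interpreted as usual. A safety 1ARA$_1$ is a tuple $\mathcal{A}=\langle \Sigma,Q,q_I,\delta\rangle$ with $\Sigma$ a finite alphabet, $Q$ a finite set of states, $q_I\in Q$, and $\delta:(Q\times\Sigma\times\{\uparrow,\not\uparrow\})\to\mathcal{B}^+_\downarrow(Q)$.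 A configuration for a data word $\sigma$ is a pair $\langle q,D\rangle$ with $q\in Q$ and $D$ an equivalence class of $\sim$. For a position $i$ and finite sets $F,F'$ of configurations, $F\xrightarrow{\sigma,i}F'$ iff for each $\langle q,D\rangle\in F$ there are $Q^{\langle q,D\rangle},Q^{\langle q,D\rangle}_\downarrow\subseteq Q$ satisfying $\delta(q,\sigma(i),\uparrow)$ if $D=[i]_\sim$, or $\delta(q,\sigma(i),\not\uparrow)$ if $D\neq[i]_\sim$, such that $F'=\{\langle q',D\rangle:\langle q,D\rangle\in F,\ q'\in Q^{\langle q,D\rangle}\}\cup\{\langle q',[i]_\sim\rangle:\langle q,D\rangle\in F,\ q'\in Q^{\langle q,D\rangle}_\downarrow\}$. $\mathcal{A}$ accepts $\sigma$ iff there is an infinite sequence $F_0\xrightarrow{\sigma,0}F_1\xrightarrow{\sigma,1}\cdots$ with $F_0=\{\langle q_I,[0]_\sim\rangle\}$; $\mathrm{L}(\mathcal{A})$ is the set of accepted data $\omega$-words over $\Sigma$. -}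

module Defs where

open import Level using (0ℓ)
open import Data.Nat using (ℕ; zero; suc; _<_)
open import Data.Fin using (Fin)
open import Data.Fin.Subset using (Subset; _∈_)
open import Data.Product using (Σ; ∃; ∃-syntax; _×_; _,_; proj₁; proj₂)
open import Data.Sum using (_⊎_)
open import Data.Unit using (⊤)
open import Data.Empty using (⊥)
open import Data.List using (List)
open import Data.List.Relation.Unary.Any using (Any)
open import Relation.Nullary using (¬_)
open import Relation.Binary using (IsEquivalence)
open import Relation.Binary.PropositionalEquality using (_≡_)
open import Function.Bundles using (_⇔_)

record DataWord (k : ℕ) : Set₁ where
  field
    str     : ℕ → Fin k
    _∼_     : ℕ → ℕ → Set
    isEquiv : IsEquivalence _∼_

open DataWord public

SamePrefix : ∀ {k} → ℕ → DataWord k → DataWord k → Set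
SamePrefix i σ σ' =
  (∀ m → m < i → str σ m ≡ str σ' m) ×
  (∀ m l → m < i → l < i → (_∼_ σ m l ⇔ _∼_ σ' m l))

data PBF (Q : Set) : Set where
  atom  : Q → PBF Q
  down  : Q → PBF Q
  tt    : PBF Q
  ff    : PBF Q
  _∧ᶠ_  : PBF Q → PBF Q → PBF Q
  _∨ᶠ_  : PBF Q → PBF Q → PBF Q

Sat : ∀ {n} → Subset n → Subset n → PBF (Fin n) → Set
Sat Q' Q↓ (atom q) = q ∈ Q'
Sat Q' Q↓ (down q) = q ∈ Q↓
Sat Q' Q↓ tt       = ⊤
Sat Q' Q↓ ff       = ⊥
Sat Q' Q↓ (φ ∧ᶠ ψ) = Sat Q' Q↓ φ × Sat Q' Q↓ ψ
Sat Q' Q↓ (φ ∨ᶠ ψ) = Sat Q' Q↓ φ ⊎ Sat Q' Q↓ ψ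

data Mode : Set where
  up notup : Mode

record ARA1 (k : ℕ) : Set where
  field
    nQ : ℕ
    qI : Fin nQ
    δ  : Fin nQ → Fin k → Mode → PBF (Fin nQ)

open ARA1 public

-- A configuration ⟨q , D⟩ is written ⟨q , [j]⟩
-- via a representative position j of the class D.  A set of
-- configurations is a predicate F q j that is invariant under ∼ in j.

ConfSet : ∀ {k} → ARA1 k → Set₁
ConfSet A = Fin (nQ A) → ℕ → Set

module _ {k} (A : ARA1 k) (σ : DataWord k) where

  private
    _≈_ = _∼_ σ

  ClassInvariant : ConfSet A → Set
  ClassInvariant F = ∀ q j j' → j ≈ j' → F q j → F q j'

  Finite : ConfSet A → Set
  Finite F = ∃[ L ] (∀ q j → (F q j ⇔ Any (λ p → q ≡ proj₁ p × j ≈ proj₂ p) L))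

  -- F --σ,i--> F'
  -- The choice of (Q^⟨q,D⟩ , Q^⟨q,D⟩_↓) is a function c of the
  -- configuration (i.e. of q and of the class of j).
  Step : ℕ → ConfSet A → ConfSet A → Set
  Step i F F' =
    ClassInvariant F × Finite F × ClassInvariant F' × Finite F' ×
    Σ (Fin (nQ A) → ℕ → Subset (nQ A) × Subset (nQ A)) λ c →
      (∀ q j j' → j ≈ j' → c q j ≡ c q j') ×
      (∀ q j → F q j →
          (j ≈ i → Sat (proj₁ (c q j)) (proj₂ (c q j)) (δ A q (str σ i) up)) ×
          (¬ (j ≈ i) → Sat (proj₁ (c q j)) (proj₂ (c q j)) (δ A q (str σ i) notup))) ×
      (∀ q' j' → F' q' j' ⇔
          ((∃[ q ] ∃[ j ] (F q j × q' ∈ proj₁ (c q j) × j' ≈ j)) ⊎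
           (∃[ q ] ∃[ j ] (F q j × q' ∈ proj₂ (c q j) × j' ≈ i))))

  IsInitial : ConfSet A → Set
  IsInitial F = ∀ q j → (F q j ⇔ (q ≡ qI A × j ≈ 0))

  Accepts : Set₁
  Accepts = Σ (ℕ → ConfSet A) λ F → IsInitial (F 0) × (∀ i → Step i (F i) (F (suc i)))

_∈L_ : ∀ {k} → DataWord k → ARA1 k → Set₁
σ ∈L A = Accepts A σ

module Submission where

-- The proof is a compactness argument.  Call a configuration ⟨q,[j]⟩ at
-- position i "n-surviving" if the automaton can be run from it through n more
-- positions of σ, always satisfying the transition formulae.
--  * Configurations of an accepting run survive for every n, and n-survival
--    from position 0 only inspects the (n+1)-prefix of σ; hence the initial
--    configuration of σ is n-surviving for every n, witnessed by the accepted
--    word sharing that prefix.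
--  * A positive Boolean formula that holds under each valuation of a
--    descending family holds under their intersection: at a disjunction one
--    of the two disjuncts must hold at every stage.  This pigeonhole step is
--    the one place where excluded middle is used (besides making the chosen
--    state sets and the finiteness lists decidable).
--  * Hence the run that always moves to all "safe" (n-surviving for all n)
--    successors is an accepting run of σ.

open import Defs
open import Level using (0ℓ; Lift; lift; lower)
open import Axiom.ExcludedMiddle using (ExcludedMiddle)
open import Data.Nat using (ℕ; zero; suc; _+_; _≤_; _<_; _>_; _≤′_; ≤′-refl; ≤′-step; z≤n; s≤s)
open import Data.Nat.Properties
  using (≤-trans; ≤-<-trans; m≤m+n; m≤n+m; n≤1+n; m≤n⇒m≤1+n; +-suc; ≤⇒≤′)
open import Data.Fin using (Fin)
open import Data.Fin.Subset using (Subset; _∈_)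
open import Data.Vec using (tabulate)
open import Data.Vec.Properties using (lookup∘tabulate; tabulate-cong; []=⇒lookup; lookup⇒[]=)
open import Data.Product using (∃-syntax; _×_; _,_; proj₁; proj₂)
open import Data.Sum using (_⊎_; inj₁; inj₂)
open import Data.Unit using (⊤; tt)
open import Data.Empty using (⊥; ⊥-elim)
open import Data.List using (List; allFin; upTo; cartesianProduct; filter)
import Data.List.Relation.Unary.Any as Any
open import Data.List.Membership.Propositional using (find)
open import Data.List.Membership.Propositional.Properties
  using (∈-allFin; ∈-upTo⁺; ∈-cartesianProduct⁺; ∈-filter⁺; ∈-filter⁻)
open import Relation.Nullary using (¬_; Dec; yes; no; does; proof)
open import Relation.Nullary.Reflects using (Reflects; invert)
open import Relation.Nullary.Decidable using (map′; dec-true; does-⇔)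
open import Relation.Binary using (IsEquivalence)
open import Relation.Binary.PropositionalEquality using (_≡_; refl; sym; trans; cong₂; subst)
open import Function.Bundles using (_⇔_; mk⇔; Equivalence)

Holds : {Q : Set} → (Q → Set) → (Q → Set) → PBF Q → Set
Holds P P↓ (atom q) = P q
Holds P P↓ (down q) = P↓ q
Holds P P↓ tt       = ⊤
Holds P P↓ ff       = ⊥
Holds P P↓ (φ ∧ᶠ ψ) = Holds P P↓ φ × Holds P P↓ ψ
Holds P P↓ (φ ∨ᶠ ψ) = Holds P P↓ φ ⊎ Holds P P↓ ψ

holds-mono : {Q : Set} {P P' P↓ P↓' : Q → Set} →
             (∀ {q} → P q → P' q) → (∀ {q} → P↓ q → P↓' q) →
             ∀ φ → Holds P P↓ φ → Holds P' P↓' φ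
holds-mono f g (atom q) h         = f h
holds-mono f g (down q) h         = g h
holds-mono f g tt h               = h
holds-mono f g ff h               = h
holds-mono f g (φ ∧ᶠ ψ) (h , h')  = holds-mono f g φ h , holds-mono f g ψ h'
holds-mono f g (φ ∨ᶠ ψ) (inj₁ h)  = inj₁ (holds-mono f g φ h)
holds-mono f g (φ ∨ᶠ ψ) (inj₂ h)  = inj₂ (holds-mono f g ψ h)

sat⇒holds : ∀ {n} {Q' Q↓ : Subset n} φ → Sat Q' Q↓ φ → Holds (_∈ Q') (_∈ Q↓) φ
sat⇒holds (atom q) s          = s
sat⇒holds (down q) s          = s
sat⇒holds tt s                = s
sat⇒holds (φ ∧ᶠ ψ) (s , s')   = sat⇒holds φ s , sat⇒holds ψ s'
sat⇒holds (φ ∨ᶠ ψ) (inj₁ s)   = inj₁ (sat⇒holds φ s)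
sat⇒holds (φ ∨ᶠ ψ) (inj₂ s)   = inj₂ (sat⇒holds ψ s)

holds⇒sat : ∀ {n} {Q' Q↓ : Subset n} φ → Holds (_∈ Q') (_∈ Q↓) φ → Sat Q' Q↓ φ
holds⇒sat (atom q) h          = h
holds⇒sat (down q) h          = h
holds⇒sat tt h                = h
holds⇒sat (φ ∧ᶠ ψ) (h , h')   = holds⇒sat φ h , holds⇒sat ψ h'
holds⇒sat (φ ∨ᶠ ψ) (inj₁ h)   = inj₁ (holds⇒sat φ h)
holds⇒sat (φ ∨ᶠ ψ) (inj₂ h)   = inj₂ (holds⇒sat ψ h)

Descending : (ℕ → Set) → Set
Descending P = ∀ n → P (suc n) → P n

descending-≤ : {P : ℕ → Set} → Descending P → ∀ {m n} → m ≤ n → P n → P m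
descending-≤ {P} d m≤n = go (≤⇒≤′ m≤n)
  where
  go : ∀ {m n} → m ≤′ n → P n → P m
  go ≤′-refl        p = p
  go (≤′-step m≤′n) p = go m≤′n (d _ p)

module Classical (lem : ExcludedMiddle (Level.suc 0ℓ)) where

  dec : (P : Set) → Dec P
  dec P = map′ lower lift (lem {Lift (Level.suc 0ℓ) P})

  descending-⊎ : {P R : ℕ → Set} → Descending P → Descending R →
                 (∀ n → P n ⊎ R n) → (∀ n → P n) ⊎ (∀ n → R n)
  descending-⊎ {P} {R} dP dR some with dec (∀ n → P n)
  ... | yes allP = inj₁ allP
  ... | no ¬allP = inj₂ allR
    where
    allR : ∀ m → R m
    allR m with dec (R m)
    ... | yes r  = r
    ... | no ¬r  = ⊥-elim (¬allP allP)
      where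
      allP : ∀ n → P n
      allP n with some (m + n)
      ... | inj₁ p = descending-≤ dP (m≤n+m n m) p
      ... | inj₂ r = ⊥-elim (¬r (descending-≤ dR (m≤m+n m n) r))

  holds-⋂ : {Q : Set} {P P↓ : ℕ → Q → Set} →
            (∀ n {q} → P (suc n) q → P n q) → (∀ n {q} → P↓ (suc n) q → P↓ n q) →
            ∀ φ → (∀ n → Holds (P n) (P↓ n) φ) →
            Holds (λ q → ∀ n → P n q) (λ q → ∀ n → P↓ n q) φ
  holds-⋂ dP dP↓ (atom q) h = h
  holds-⋂ dP dP↓ (down q) h = h
  holds-⋂ dP dP↓ tt h       = tt
  holds-⋂ dP dP↓ ff h       = h 0
  holds-⋂ dP dP↓ (φ ∧ᶠ ψ) h =
    holds-⋂ dP dP↓ φ (λ n → proj₁ (h n)) , holds-⋂ dP dP↓ ψ (λ n → proj₂ (h n))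
  holds-⋂ {P = P} {P↓} dP dP↓ (φ ∨ᶠ ψ) h with descending-⊎ (descends φ) (descends ψ) h
    where
    descends : ∀ χ → Descending (λ n → Holds (P n) (P↓ n) χ)
    descends χ n = holds-mono (dP n) (dP↓ n) χ
  ... | inj₁ hφ = inj₁ (holds-⋂ dP dP↓ φ hφ)
  ... | inj₂ hψ = inj₂ (holds-⋂ dP dP↓ ψ hψ)

  ⟦_⟧ : ∀ {n} → (Fin n → Set) → Subset n
  ⟦ P ⟧ = tabulate (λ q → does (dec (P q)))

  ∈⟦⟧⁻ : ∀ {n} {P : Fin n → Set} q → q ∈ ⟦ P ⟧ → P q
  ∈⟦⟧⁻ {P = P} q q∈ =
    invert (subst (Reflects (P q)) (trans (sym (lookup∘tabulate _ q)) ([]=⇒lookup q∈))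
                  (proof (dec (P q))))

  ∈⟦⟧⁺ : ∀ {n} {P : Fin n → Set} q → P q → q ∈ ⟦ P ⟧
  ∈⟦⟧⁺ {P = P} q p = lookup⇒[]= q _ (trans (lookup∘tabulate _ q) (dec-true (dec (P q)) p))

  ⟦⟧-cong : ∀ {n} {P P' : Fin n → Set} → (∀ q → P q ⇔ P' q) → ⟦ P ⟧ ≡ ⟦ P' ⟧
  ⟦⟧-cong P⇔P' = tabulate-cong (λ q → does-⇔ (P⇔P' q) (dec _) (dec _))

  bounded⇒finite : ∀ {k} (A : ARA1 k) (σ : DataWord k) (G : ConfSet A) (b : ℕ) →
                   ClassInvariant A σ G →
                   (∀ q j → G q j → ∃[ j' ] (j' < b × _∼_ σ j j' × G q j')) →
                   Finite A σ G
  bounded⇒finite A σ G b invariant bounded = candidates , λ q j → mk⇔ (listed q j) (unlisted q j)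
    where
    open IsEquivalence (isEquiv σ) using () renaming (sym to ∼-sym)
    inG : ∀ p → Dec (G (proj₁ p) (proj₂ p))
    inG p = dec _
    below-b : List (Fin (nQ A) × ℕ)
    below-b = cartesianProduct (allFin (nQ A)) (upTo b)
    candidates : List (Fin (nQ A) × ℕ)
    candidates = filter inG below-b
    listed : ∀ q j → G q j → Any.Any (λ p → q ≡ proj₁ p × _∼_ σ j (proj₂ p)) candidates
    listed q j g with j' , j'<b , j∼j' , g' ← bounded q j g =
      Any.map (λ { refl → refl , j∼j' })
        (∈-filter⁺ inG (∈-cartesianProduct⁺ (∈-allFin q) (∈-upTo⁺ j'<b)) g')
    unlisted : ∀ q j → Any.Any (λ p → q ≡ proj₁ p × _∼_ σ j (proj₂ p)) candidates → G q j
    unlisted q j listed with (q' , j') , p∈ , refl , j∼j' ← find listed =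
      invariant q j' j (∼-sym j∼j') (proj₂ (∈-filter⁻ inG {xs = below-b} p∈))

module Survival {k} (A : ARA1 k) where

  private
    State = Fin (nQ A)

  -- Obligation σ i j q P P↓: the transition formula of configuration ⟨q,[j]⟩
  -- at position i holds when a successor ⟨q',[j]⟩ (atom q') counts iff P q'
  -- and a successor ⟨q',[i]⟩ (atom ↓q') counts iff P↓ q'.
  Obligation : DataWord k → ℕ → ℕ → State → (State → Set) → (State → Set) → Set
  Obligation σ i j q P P↓ =
    (_∼_ σ j i → Holds P P↓ (δ A q (str σ i) up)) ×
    (¬ _∼_ σ j i → Holds P P↓ (δ A q (str σ i) notup))

  obligation-mono : ∀ σ i j q {P P' P↓ P↓' : State → Set} →
                    (∀ {q'} → P q' → P' q') → (∀ {q'} → P↓ q' → P↓' q') →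
                    Obligation σ i j q P P↓ → Obligation σ i j q P' P↓'
  obligation-mono σ i j q f g (up′ , notup′) =
    (λ j∼i → holds-mono f g (δ A q (str σ i) up) (up′ j∼i)) ,
    (λ j≁i → holds-mono f g (δ A q (str σ i) notup) (notup′ j≁i))

  obligation-transfer : ∀ σ σ' i j j' q {P P↓ : State → Set} →
                        str σ i ≡ str σ' i → (_∼_ σ j i ⇔ _∼_ σ' j' i) →
                        Obligation σ' i j' q P P↓ → Obligation σ i j q P P↓
  obligation-transfer σ σ' i j j' q same-letter j∼i⇔ (up′ , notup′)
    rewrite same-letter =
    (λ j∼i → up′ (Equivalence.to j∼i⇔ j∼i)) ,
    (λ j≁i → notup′ (λ j'∼i → j≁i (Equivalence.from j∼i⇔ j'∼i)))

  Survives : DataWord k → ℕ → ℕ → State → ℕ → Set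
  Survives σ zero    i q j = ⊤
  Survives σ (suc n) i q j =
    Obligation σ i j q (λ q' → Survives σ n (suc i) q' j) (λ q' → Survives σ n (suc i) q' i)

  survives-pred : ∀ σ n i q j → Survives σ (suc n) i q j → Survives σ n i q j
  survives-pred σ zero    i q j s = tt
  survives-pred σ (suc n) i q j s =
    obligation-mono σ i j q (survives-pred σ n (suc i) _ j) (survives-pred σ n (suc i) _ i) s

  survives-resp : ∀ σ n i q {j j'} → _∼_ σ j j' → Survives σ n i q j → Survives σ n i q j'
  survives-resp σ zero    i q j∼j' s = tt
  survives-resp σ (suc n) i q {j} {j'} j∼j' s =
    obligation-mono σ i j' q (survives-resp σ n (suc i) _ j∼j') (λ s' → s')
      (obligation-transfer σ σ i j' j q refl (mk⇔ (∼-trans j∼j') (∼-trans (∼-sym j∼j'))) s)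
    where open IsEquivalence (isEquiv σ) using () renaming (sym to ∼-sym; trans to ∼-trans)

  -- n-survival before position i only reads positions up to i + n - 1 of σ
  -- (classes are compared only among positions j ≤ i there).
  survives-prefix : ∀ {σ σ' m} → SamePrefix m σ σ' →
                    ∀ n i q j → j ≤ i → i + n ≤ m → Survives σ' n i q j → Survives σ n i q j
  survives-prefix sp zero    i q j j≤i i+n≤m s = tt
  survives-prefix {σ} {σ'} {m} sp (suc n) i q j j≤i i+1+n≤m s =
    obligation-mono σ i j q
      (survives-prefix sp n (suc i) _ j (m≤n⇒m≤1+n j≤i) 1+i+n≤m)
      (survives-prefix sp n (suc i) _ i (n≤1+n i) 1+i+n≤m)
      (obligation-transfer σ σ' i j j q (proj₁ sp i i<m) (proj₂ sp j i j<m i<m) s)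
    where
    1+i+n≤m : suc i + n ≤ m
    1+i+n≤m = subst (_≤ m) (+-suc i n) i+1+n≤m
    i<m : i < m
    i<m = ≤-trans (s≤s (m≤m+n i n)) 1+i+n≤m
    j<m : j < m
    j<m = ≤-<-trans j≤i i<m

  obligation⇒sat : ∀ σ i j q {Q' Q↓ : Subset (nQ A)} → Obligation σ i j q (_∈ Q') (_∈ Q↓) →
                   (_∼_ σ j i → Sat Q' Q↓ (δ A q (str σ i) up)) ×
                   (¬ _∼_ σ j i → Sat Q' Q↓ (δ A q (str σ i) notup))
  obligation⇒sat σ i j q (up′ , notup′) =
    (λ j∼i → holds⇒sat _ (up′ j∼i)) , (λ j≁i → holds⇒sat _ (notup′ j≁i))

  sat⇒obligation : ∀ σ i j q {Q' Q↓ : Subset (nQ A)} →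
                   (_∼_ σ j i → Sat Q' Q↓ (δ A q (str σ i) up)) ×
                   (¬ _∼_ σ j i → Sat Q' Q↓ (δ A q (str σ i) notup)) →
                   Obligation σ i j q (_∈ Q') (_∈ Q↓)
  sat⇒obligation σ i j q (up′ , notup′) =
    (λ j∼i → sat⇒holds _ (up′ j∼i)) , (λ j≁i → sat⇒holds _ (notup′ j≁i))

  run⇒survives : ∀ {σ} (acc : σ ∈L A) → ∀ n i q j → proj₁ acc i q j → Survives σ n i q j
  run⇒survives acc zero i q j inF = tt
  run⇒survives {σ} acc@(_ , _ , steps) (suc n) i q j inF
    with _ , _ , _ , _ , _ , _ , sat , F′≡ ← steps i =
    obligation-mono σ i j q
      (λ {q'} q'∈ → run⇒survives acc n (suc i) q' j
                      (Equivalence.from (F′≡ q' j) (inj₁ (q , j , inF , q'∈ , ∼-refl))))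
      (λ {q'} q'∈ → run⇒survives acc n (suc i) q' i
                      (Equivalence.from (F′≡ q' i) (inj₂ (q , j , inF , q'∈ , ∼-refl))))
      (sat⇒obligation σ i j q (sat q j inF))
    where open IsEquivalence (isEquiv σ) using () renaming (refl to ∼-refl)

  accepted⇒initial-survives : ∀ {σ} → σ ∈L A → ∀ n → Survives σ n 0 (qI A) 0
  accepted⇒initial-survives {σ} acc@(_ , initial , _) n =
    run⇒survives acc n 0 (qI A) 0 (Equivalence.from (initial (qI A) 0) (refl , ∼-refl))
    where open IsEquivalence (isEquiv σ) using () renaming (refl to ∼-refl)

module SurvivorRun (lem : ExcludedMiddle (Level.suc 0ℓ)) {k} (A : ARA1 k) (σ : DataWord k) where
  open Classical lem
  open Survival A
  open IsEquivalence (isEquiv σ) using () renaming (refl to ∼-refl; sym to ∼-sym; trans to ∼-trans)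

  private
    State = Fin (nQ A)
    _≈_ = _∼_ σ

  Safe : ℕ → State → ℕ → Set
  Safe i q j = ∀ n → Survives σ n i q j

  safe-resp : ∀ i q {j j'} → j ≈ j' → Safe i q j → Safe i q j'
  safe-resp i q j≈j' safe n = survives-resp σ n i q j≈j' (safe n)

  safe-obligation : ∀ i q j → Safe i q j →
                    Obligation σ i j q (λ q' → Safe (suc i) q' j) (λ q' → Safe (suc i) q' i)
  safe-obligation i q j safe =
    (λ j∼i → holds-⋂ (fewer-steps j) (fewer-steps i) (δ A q (str σ i) up) (λ n → proj₁ (safe (suc n)) j∼i)) ,
    (λ j≁i → holds-⋂ (fewer-steps j) (fewer-steps i) (δ A q (str σ i) notup) (λ n → proj₂ (safe (suc n)) j≁i))
    where
    fewer-steps : ∀ j' n {q'} → Survives σ (suc n) (suc i) q' j' → Survives σ n (suc i) q' j'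
    fewer-steps j' n = survives-pred σ n (suc i) _ j'

  choice : ℕ → State → ℕ → Subset (nQ A) × Subset (nQ A)
  choice i q j = ⟦ (λ q' → Safe (suc i) q' j) ⟧ , ⟦ (λ q' → Safe (suc i) q' i) ⟧

  choice-resp : ∀ i q j j' → j ≈ j' → choice i q j ≡ choice i q j'
  choice-resp i q j j' j≈j' =
    cong₂ _,_ (⟦⟧-cong (λ q' → mk⇔ (safe-resp (suc i) q' j≈j') (safe-resp (suc i) q' (∼-sym j≈j'))))
              refl

  -- The configuration sets of the run, defined so that each Step holds by
  -- construction.
  F : ℕ → ConfSet A
  F zero    q  j  = q ≡ qI A × j ≈ 0
  F (suc i) q' j' =
    (∃[ q ] ∃[ j ] (F i q j × q' ∈ proj₁ (choice i q j) × j' ≈ j)) ⊎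
    (∃[ q ] ∃[ j ] (F i q j × q' ∈ proj₂ (choice i q j) × j' ≈ i))

  F-invariant : ∀ i → ClassInvariant A σ (F i)
  F-invariant zero    q j j' j≈j' (q≡qI , j≈0)              = q≡qI , ∼-trans (∼-sym j≈j') j≈0
  F-invariant (suc i) q j j' j≈j' (inj₁ (q₀ , j₀ , x , m , e)) = inj₁ (q₀ , j₀ , x , m , ∼-trans (∼-sym j≈j') e)
  F-invariant (suc i) q j j' j≈j' (inj₂ (q₀ , j₀ , x , m , e)) = inj₂ (q₀ , j₀ , x , m , ∼-trans (∼-sym j≈j') e)

  F-bounded : ∀ i q j → F i q j → ∃[ j' ] (j' < suc i × j ≈ j' × F i q j')
  F-bounded zero    q j (q≡qI , j≈0) = 0 , s≤s z≤n , j≈0 , q≡qI , ∼-refl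
  F-bounded (suc i) q' j' (inj₁ (q , j , x , m , j'≈j))
    with j₀ , j₀≤i , j≈j₀ , _ ← F-bounded i q j x =
    j₀ , m≤n⇒m≤1+n j₀≤i , ∼-trans j'≈j j≈j₀ , inj₁ (q , j , x , m , ∼-sym j≈j₀)
  F-bounded (suc i) q' j' (inj₂ (q , j , x , m , j'≈i)) =
    i , s≤s (n≤1+n i) , j'≈i , inj₂ (q , j , x , m , ∼-refl)

  F-finite : ∀ i → Finite A σ (F i)
  F-finite i = bounded⇒finite A σ (F i) (suc i) (F-invariant i) (F-bounded i)

  F-safe : Safe 0 (qI A) 0 → ∀ i q j → F i q j → Safe i q j
  F-safe safe₀ zero    q j (refl , j≈0) = safe-resp 0 q (∼-sym j≈0) safe₀
  F-safe safe₀ (suc i) q' j' (inj₁ (_ , _ , _ , m , j'≈j)) = safe-resp (suc i) q' (∼-sym j'≈j) (∈⟦⟧⁻ q' m)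
  F-safe safe₀ (suc i) q' j' (inj₂ (_ , _ , _ , m , j'≈i)) = safe-resp (suc i) q' (∼-sym j'≈i) (∈⟦⟧⁻ q' m)

  run : Safe 0 (qI A) 0 → σ ∈L A
  run safe₀ = F , (λ q j → mk⇔ (λ x → x) (λ x → x)) , step
    where
    step : ∀ i → Step A σ i (F i) (F (suc i))
    step i = F-invariant i , F-finite i , F-invariant (suc i) , F-finite (suc i) ,
             choice i , choice-resp i ,
             (λ q j x → obligation⇒sat σ i j q
                          (obligation-mono σ i j q (∈⟦⟧⁺ _) (∈⟦⟧⁺ _) (safe-obligation i q j (F-safe safe₀ i q j x)))) ,
             (λ q' j' → mk⇔ (λ x → x) (λ x → x))

proposition2p2 : ExcludedMiddle (Level.suc 0ℓ) →
    ∀ {k : ℕ} (A : ARA1 k) (σ : DataWord k) →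
    (∀ i → i > 0 → ∃[ σ' ] (σ' ∈L A × SamePrefix i σ σ')) →
    σ ∈L A
proposition2p2 lem A σ prefixes-extend = SurvivorRun.run lem A σ initial-safe
  where
  open Survival A
  -- n-survival of the initial configuration is decided by the (n+1)-prefix,
  -- which σ shares with an accepted word.
  initial-safe : ∀ n → Survives σ n 0 (qI A) 0
  initial-safe n with σ' , accepted , same-prefix ← prefixes-extend (suc n) (s≤s z≤n) =
    survives-prefix {σ} {σ'} same-prefix n 0 (qI A) 0 z≤n (n≤1+n n)
      (accepted⇒initial-survives accepted n)
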